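{- For a graph $P$, $\mathrm{cov}_{A'}(P)=2$ if and only if $\mathrm{diam}(P)\geq 5$.
   Context: All graphs are finite and simple. Distances are in $P$ ($\infty$ if no path); for a vertex $p$ and vertex sets $S,T$, $d(S,p)=\min_{s\in S}d(s,p)$ and $d(S,T)=\min_{s\in S,t\in T}d(s,t)$. $\mathrm{diam}$ is the maximum eccentricity (infinite for disconnected graphs). A covering of $P$ is a family $\{P_1,\dots,P_k\}$ of subsets of $V(P)$ with $\bigcup P_i=V(P)$; $k$ is its size. Condition A$'$: for each $i$, either there is $p\notin P_i$ with $d(P_i,p)\geq 3$, or there is $j\neq i$ with $d(P_i,P_j)\geq 2$. $\mathrm{cov}_{A'}(P)$ is the smallest size of a covering of $P$ satisfying condition A$'$. -}

module Defs where

open import Data.Nat using (ℕ; zero; suc; _<_)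
open import Data.Fin using (Fin)
open import Data.Fin.Subset using (Subset; _∈_; _∉_; Nonempty)
open import Data.Bool using (Bool; true; false)
open import Data.Product using (Σ; ∃; ∃-syntax; _×_; _,_)
open import Data.Sum using (_⊎_)
open import Relation.Nullary using (¬_)
open import Relation.Binary.PropositionalEquality using (_≡_; _≢_)

record Graph (n : ℕ) : Set where
  field
    adj     : Fin n → Fin n → Bool
    adj-sym : ∀ u v → adj u v ≡ adj v u
    irrefl  : ∀ u → adj u u ≡ false

module _ {n : ℕ} (G : Graph n) where
  open Graph G

  Edge : Fin n → Fin n → Set
  Edge u v = adj u v ≡ true

  data Walk : Fin n → Fin n → ℕ → Set where
    nil  : ∀ u → Walk u u zero
    cons : ∀ {u v w k} → Edge u v → Walk v w k → Walk u w (suc k)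

  -- d(u,v) ≥ k  (distance infinite when no path): no walk of length < k
  DistGe : Fin n → Fin n → ℕ → Set
  DistGe u v k = ¬ (∃[ m ] (m < k × Walk u v m))

  SetPtDistGe : Subset n → Fin n → ℕ → Set
  SetPtDistGe S p k = ∀ s → s ∈ S → DistGe s p k

  SetSetDistGe : Subset n → Subset n → ℕ → Set
  SetSetDistGe S T k = ∀ s t → s ∈ S → t ∈ T → DistGe s t k

  IsCovering : (k : ℕ) → (Fin k → Subset n) → Set
  IsCovering k F = (∀ i → Nonempty (F i)) × (∀ v → ∃[ i ] (v ∈ F i))

  CondA' : (k : ℕ) → (Fin k → Subset n) → Set
  CondA' k F = ∀ i →
    (∃[ p ] (p ∉ F i × SetPtDistGe (F i) p 3))
    ⊎ (∃[ j ] (j ≢ i × SetSetDistGe (F i) (F j) 2))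

  HasCovA' : ℕ → Set
  HasCovA' k = Σ (Fin k → Subset n) λ F → IsCovering k F × CondA' k F

  CovA'≡ : ℕ → Set
  CovA'≡ k = HasCovA' k × (∀ m → m < k → ¬ HasCovA' m)

  -- diam(G) ≥ k (diam = max eccentricity; ∞ for disconnected graphs)
  DiamGe : ℕ → Set
  DiamGe k = ∃[ u ] ∃[ v ] DistGe u v k

-- If A' is witnessed by a gap d(P₁,P₂) ≥ 2 the graph is disconnected. Otherwise
-- each part Pᵢ has a point at distance ≥ 3 from it, and that point lies in the
-- other part; the vertex two steps along a short walk between the two points
-- would be within distance 2 of the far point of its own part, so the points
-- are at distance ≥ 5. Conversely, if d(u,v) ≥ 5, the ball of radius 2 around
-- u and its complement form a covering satisfying A', with v and u as the far
-- points; one set can never satisfy A'.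
module Submission where

open import Defs
open import Data.Nat using (ℕ; zero; suc; _+_; _<_; _≤_; z≤n; s≤s)
open import Data.Nat.Properties using (anyUpTo?; +-mono-≤; <-≤-trans; <⇒≱)
open import Data.Fin using (Fin; zero; suc)
open import Data.Fin.Properties using (any?) renaming (_≟_ to _≟ᶠ_)
open import Data.Fin.Subset using (Subset; _∈_; _∉_; ∁; Nonempty)
open import Data.Fin.Subset.Properties using (_∈?_; x∈p⇒x∉∁p; x∉p⇒x∈∁p)
open import Data.Vec using (tabulate)
open import Data.Vec.Properties using ([]=⇒lookup; lookup⇒[]=; lookup∘tabulate)
open import Data.Bool using (true)
open import Data.Bool.Properties using (T-≡) renaming (_≟_ to _≟ᵇ_)
open import Data.Product using (∃-syntax; _×_; _,_)
open import Data.Sum using (_⊎_; inj₁; inj₂; swap)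
open import Data.Empty using (⊥-elim)
open import Function using (_∘_)
open import Function.Bundles using (_⇔_; mk⇔; Equivalence)
open import Relation.Nullary using (¬_; Dec; yes; no)
open import Relation.Nullary.Decidable using (map′; _×-dec_; isYes; toWitness; fromWitness)
open import Relation.Unary using (Pred; Decidable)
open import Relation.Binary.PropositionalEquality using (refl; sym; trans)

module _ {n : ℕ} where

  ⟦_⟧ : ∀ {ℓ} {P : Pred (Fin n) ℓ} → Decidable P → Subset n
  ⟦ P? ⟧ = tabulate (isYes ∘ P?)

  module _ {ℓ} {P : Pred (Fin n) ℓ} (P? : Decidable P) {x : Fin n} where

    ∈⟦⟧⁺ : P x → x ∈ ⟦ P? ⟧
    ∈⟦⟧⁺ Px = lookup⇒[]= x _
      (trans (lookup∘tabulate _ x) (Equivalence.to T-≡ (fromWitness {a? = P? x} Px)))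

    ∈⟦⟧⁻ : x ∈ ⟦ P? ⟧ → P x
    ∈⟦⟧⁻ x∈ = toWitness {a? = P? x}
      (Equivalence.from T-≡ (trans (sym (lookup∘tabulate _ x)) ([]=⇒lookup x∈)))

module _ {n : ℕ} (G : Graph n) where
  open Graph G

  Edge-sym : ∀ {u v} → Edge G u v → Edge G v u
  Edge-sym {u} {v} e = trans (adj-sym v u) e

  _∷ʳ_ : ∀ {u v w k} → Walk G u v k → Edge G v w → Walk G u w (suc k)
  nil _    ∷ʳ e = cons e (nil _)
  cons f w ∷ʳ e = cons f (w ∷ʳ e)

  reverse : ∀ {u v k} → Walk G u v k → Walk G v u k
  reverse (nil _)    = nil _
  reverse (cons e w) = reverse w ∷ʳ Edge-sym e

  _++_ : ∀ {u v w k l} → Walk G u v k → Walk G v w l → Walk G u w (k + l)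
  nil _    ++ w′ = w′
  cons e w ++ w′ = cons e (w ++ w′)

  walk? : ∀ u v k → Dec (Walk G u v k)
  walk? u v zero = map′ (λ { refl → nil u }) (λ { (nil _) → refl }) (u ≟ᶠ v)
  walk? u v (suc k) =
    map′ (λ (w , e , p) → cons e p) (λ { (cons e p) → _ , e , p })
         (any? λ w → (adj u w ≟ᵇ true) ×-dec walk? w v k)

  -- d(u,v) < k, so that DistGe G u v k is definitionally ¬ Within u v k.
  Within : Fin n → Fin n → ℕ → Set
  Within u v k = ∃[ m ] (m < k × Walk G u v m)

  within? : ∀ u v k → Dec (Within u v k)
  within? u v = anyUpTo? (walk? u v)

  Within-refl : ∀ {u k} → Within u u (suc k)
  Within-refl {u} = 0 , s≤s z≤n , nil u

  Within-sym : ∀ {u v k} → Within u v k → Within v u k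
  Within-sym (m , m<k , w) = m , m<k , reverse w

  Within-trans : ∀ {u v w k l} → Within u v (suc k) → Within v w (suc l) →
                 Within u w (suc (k + l))
  Within-trans (m , s≤s m≤k , p) (m′ , s≤s m′≤l , q) =
    m + m′ , s≤s (+-mono-≤ m≤k m′≤l) , p ++ q

  Within-mono : ∀ {u v k l} → k ≤ l → Within u v k → Within u v l
  Within-mono k≤l (m , m<k , w) = m , <-≤-trans m<k k≤l , w

  Ball : Fin n → ℕ → Subset n
  Ball u k = ⟦ (λ v → within? u v k) ⟧

  ∈Ball⁺ : ∀ {u v k} → Within u v k → v ∈ Ball u k
  ∈Ball⁺ {u} {k = k} = ∈⟦⟧⁺ (λ v → within? u v k)

  ∈Ball⁻ : ∀ {u v k} → v ∈ Ball u k → Within u v k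
  ∈Ball⁻ {u} {k = k} = ∈⟦⟧⁻ (λ v → within? u v k)

  module _ {A B : Subset n} (covers : ∀ x → x ∈ A ⊎ x ∈ B) where

    gap⇒¬Walk : SetSetDistGe G A B 2 →
                ∀ {x y k} → x ∈ A → y ∈ B → ¬ Walk G x y k
    gap⇒¬Walk gap x∈A y∈B (nil x) = gap x x x∈A y∈B Within-refl
    gap⇒¬Walk gap {x} x∈A y∈B (cons {v = v} e w) with covers v
    ... | inj₁ v∈A = gap⇒¬Walk gap v∈A y∈B w
    ... | inj₂ v∈B = gap x v x∈A v∈B (1 , s≤s (s≤s z≤n) , cons e (nil v))

    gap⇒DiamGe : ∀ {k} → SetSetDistGe G A B 2 → Nonempty A → Nonempty B → DiamGe G k
    gap⇒DiamGe gap (x , x∈A) (y , y∈B) = x , y , λ (_ , _ , w) → gap⇒¬Walk gap x∈A y∈B w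

    farPoints⇒DistGe5 : ∀ {p q} → SetPtDistGe G A p 3 → SetPtDistGe G B q 3 →
                        q ∈ A → DistGe G q p 5
    farPoints⇒DistGe5 farA farB q∈A (_ , _ , nil q) = farA q q∈A Within-refl
    farPoints⇒DistGe5 farA farB q∈A (_ , _ , cons e (nil p)) =
      farA _ q∈A (1 , s≤s (s≤s z≤n) , cons e (nil p))
    farPoints⇒DistGe5 farA farB q∈A
      (suc (suc m) , s≤s (s≤s m<3) , cons e₁ (cons {v = x} e₂ rest)) with covers x
    ... | inj₁ x∈A = farA x x∈A (m , m<3 , rest)
    ... | inj₂ x∈B = farB x x∈B (2 , s≤s (s≤s (s≤s z≤n)) , reverse (cons e₁ (cons e₂ (nil x))))

  covers₂ : ∀ {F : Fin 2 → Subset n} → (∀ v → ∃[ i ] (v ∈ F i)) →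
            ∀ v → v ∈ F zero ⊎ v ∈ F (suc zero)
  covers₂ cov v with cov v
  ... | zero , v∈F₀ = inj₁ v∈F₀
  ... | suc zero , v∈F₁ = inj₂ v∈F₁

  HasCovA'₂⇒DiamGe5 : HasCovA' G 2 → DiamGe G 5
  HasCovA'₂⇒DiamGe5 (F , (nonempty , cov) , condA') with condA' zero | condA' (suc zero)
  ... | inj₂ (zero , 0≢0 , _) | _ = ⊥-elim (0≢0 refl)
  ... | inj₂ (suc zero , _ , gap) | _ =
    gap⇒DiamGe (covers₂ cov) gap (nonempty zero) (nonempty (suc zero))
  ... | _ | inj₂ (suc zero , 1≢1 , _) = ⊥-elim (1≢1 refl)
  ... | _ | inj₂ (zero , _ , gap) =
    gap⇒DiamGe (swap ∘ covers₂ cov) gap (nonempty (suc zero)) (nonempty zero)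
  ... | inj₁ (p , _ , farF₀) | inj₁ (q , q∉F₁ , farF₁) with covers₂ cov q
  ...   | inj₁ q∈F₀ = q , p , farPoints⇒DistGe5 (covers₂ cov) farF₀ farF₁ q∈F₀
  ...   | inj₂ q∈F₁ = ⊥-elim (q∉F₁ q∈F₁)

  DistGe5⇒HasCovA'₂ : ∀ {u v} → DistGe G u v 5 → HasCovA' G 2
  DistGe5⇒HasCovA'₂ {u} {v} far = F , (nonempty , covers) , condA'
    where
    F : Fin 2 → Subset n
    F zero       = Ball u 3
    F (suc zero) = ∁ (Ball u 3)

    u∈ball : u ∈ Ball u 3
    u∈ball = ∈Ball⁺ Within-refl

    v∉ball : v ∉ Ball u 3
    v∉ball v∈ball = far (Within-mono (s≤s (s≤s (s≤s z≤n))) (∈Ball⁻ v∈ball))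

    nonempty : ∀ i → Nonempty (F i)
    nonempty zero       = u , u∈ball
    nonempty (suc zero) = v , x∉p⇒x∈∁p v∉ball

    covers : ∀ x → ∃[ i ] (x ∈ F i)
    covers x with x ∈? Ball u 3
    ... | yes x∈ball = zero , x∈ball
    ... | no x∉ball  = suc zero , x∉p⇒x∈∁p x∉ball

    condA' : CondA' G 2 F
    condA' zero = inj₁ (v , v∉ball , λ s s∈ball s→v →
      far (Within-trans (∈Ball⁻ s∈ball) s→v))
    condA' (suc zero) = inj₁ (u , x∈p⇒x∉∁p u∈ball , λ s s∉ball s→u →
      x∈p⇒x∉∁p (∈Ball⁺ (Within-sym s→u)) s∉ball)

  -- Needs a vertex: the empty graph is covered by no sets at all.
  HasCovA'⇒2≤ : Fin n → ∀ {m} → HasCovA' G m → 2 ≤ m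
  HasCovA'⇒2≤ u {zero} (_ , (_ , cov) , _) with cov u
  ... | () , _
  HasCovA'⇒2≤ u {suc zero} (F , (_ , cov) , condA') with condA' zero
  ... | inj₁ (p , p∉F₀ , _) with cov p
  ...   | zero , p∈F₀ = ⊥-elim (p∉F₀ p∈F₀)
  HasCovA'⇒2≤ u {suc zero} _ | inj₂ (zero , 0≢0 , _) = ⊥-elim (0≢0 refl)
  HasCovA'⇒2≤ u {suc (suc m)} _ = s≤s (s≤s z≤n)

proposition5p6 : (n : ℕ) (P : Graph n) → CovA'≡ P 2 ⇔ DiamGe P 5
proposition5p6 n P = mk⇔
  (λ (cov , _) → HasCovA'₂⇒DiamGe5 P cov)
  (λ (u , v , far) →
    DistGe5⇒HasCovA'₂ P far , λ m m<2 cov → <⇒≱ m<2 (HasCovA'⇒2≤ P u cov))
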